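{- If $M=\left[\begin{smallmatrix}1&b&1\\d&0&d\\1&b&1\end{smallmatrix}\right]$ (with $b,d$ nonnegative integers), then $\text{nim}(\text{TER}(M))=0$.
   Context: For a $3\times3$ nonnegative integer matrix, the edge sums are the sums of the first row, last row, first column and last column. In the game $\text{TER}(M)$ two players alternately decrease a positive entry by 1, and the game ends as soon as one of the edge sums becomes $0$; the last player to move wins. $\text{nim}$ is the Sprague–Grundy value. -}

module Defs where

open import Data.Nat using (ℕ; zero; suc; _+_; _∸_; _≟_)
open import Data.Bool using (Bool; true; false; if_then_else_; _∨_)
open import Data.Fin using (Fin; zero; suc; _≟_)
open import Data.List using (List; []; _∷_; map; concatMap; length; allFin)
open import Data.Bool.ListAction using (any)
open import Relation.Nullary.Decidable using (does; ⌊_⌋)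

Matrix : Set
Matrix = Fin 3 → Fin 3 → ℕ

f0 f1 f2 : Fin 3
f0 = zero
f1 = suc zero
f2 = suc (suc zero)

mat : ℕ → ℕ → ℕ → ℕ → ℕ → ℕ → ℕ → ℕ → ℕ → Matrix
mat a b c d e f g h i zero zero = a
mat a b c d e f g h i zero (suc zero) = b
mat a b c d e f g h i zero (suc (suc zero)) = c
mat a b c d e f g h i (suc zero) zero = d
mat a b c d e f g h i (suc zero) (suc zero) = e
mat a b c d e f g h i (suc zero) (suc (suc zero)) = f
mat a b c d e f g h i (suc (suc zero)) zero = g
mat a b c d e f g h i (suc (suc zero)) (suc zero) = h
mat a b c d e f g h i (suc (suc zero)) (suc (suc zero)) = i

rowSum : Matrix → Fin 3 → ℕ
rowSum M r = M r f0 + M r f1 + M r f2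

colSum : Matrix → Fin 3 → ℕ
colSum M c = M f0 c + M f1 c + M f2 c

totalSum : Matrix → ℕ
totalSum M = rowSum M f0 + rowSum M f1 + rowSum M f2

isZero : ℕ → Bool
isZero zero = true
isZero (suc _) = false

ended : Matrix → Bool
ended M = isZero (rowSum M f0) ∨ isZero (rowSum M f2) ∨ isZero (colSum M f0) ∨ isZero (colSum M f2)

decr : Matrix → Fin 3 → Fin 3 → Matrix
decr M i j k l = if ⌊ i Data.Fin.≟ k ⌋ then (if ⌊ j Data.Fin.≟ l ⌋ then M k l ∸ 1 else M k l) else M k l

options : Matrix → List Matrix
options M = if ended M then [] else
  concatMap (λ i → concatMap (λ j → if isZero (M i j) then [] else decr M i j ∷ []) (allFin 3)) (allFin 3)

elem : ℕ → List ℕ → Bool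
elem n xs = any (λ x → ⌊ n Data.Nat.≟ x ⌋) xs

mexFrom : ℕ → ℕ → List ℕ → ℕ
mexFrom n zero xs = n
mexFrom n (suc k) xs = if elem n xs then mexFrom (suc n) k xs else n

-- minimum excluded value (the answer is ≤ length xs, so that fuel suffices)
mex : List ℕ → ℕ
mex xs = mexFrom 0 (length xs) xs

-- Sprague–Grundy value with fuel; every move lowers the total sum by 1,
-- so fuel = totalSum M + 1 is enough.
nimFuel : ℕ → Matrix → ℕ
nimFuel zero M = 0
nimFuel (suc k) M = mex (map (nimFuel k) (options M))

nimTER : Matrix → ℕ
nimTER M = nimFuel (suc (totalSum M)) M

-- The second player wins by mirroring.  Consider the positions
-- [[a,b,c],[d,0,d],[c,b,a]] whose first row and first column sum to at least 2.
-- Whatever entry the first player decreases, the second player decreases the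
-- centrally opposite one and is back in such a position, unless the first
-- move left some edge sum equal to 1; then the second player empties that
-- edge and wins at once.  Each round lowers a + b + c + d by 1, which bounds
-- the fuel the computation of nimTER needs.
module Submission where

open import Defs
open import Data.Bool using (true; false; if_then_else_)
open import Data.Bool.Properties using (∨-zeroʳ)
open import Data.Empty using (⊥-elim)
open import Data.Fin using (Fin; zero; suc; _≟_)
open import Data.Fin.Patterns using (0F; 1F; 2F)
open import Data.List using (List; []; _∷_; length; concatMap; allFin)
open import Data.List.Membership.Propositional using (_∈_; _∉_; lose)
open import Data.List.Membership.Propositional.Properties
  using (∈-map⁺; ∈-map⁻; ∈-concatMap⁺; ∈-concatMap⁻; ∈-allFin)
open import Data.List.Relation.Binary.Pointwise as Pointwise using (Pointwise; []; _∷_)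
open import Data.List.Relation.Unary.Any using (here; there; satisfied)
open import Data.Nat using (ℕ; zero; suc; _+_; _∸_; _≤_; _<_; s≤s; s≤s⁻¹; z<s)
open import Data.Nat.Properties
  using ( ≤-refl; ≤-reflexive; ≤-trans; <⇒≤; m≤m+n; m≤n+m; m≤n⇒m<n∨m≡n; n≤1+n
        ; m<n⇒n≢0; n≢0⇒n>0; +-suc; +-mono-≤; m∸n≤m; suc-injective)
open import Data.Nat.Tactic.RingSolver using (solve-∀)
open import Data.Product using (∃; ∃₂; _×_; _,_)
open import Data.Sum using (_⊎_; inj₁; inj₂)
open import Relation.Nullary.Decidable using (⌊_⌋)
open import Relation.Nullary.Negation using (contradiction)
open import Relation.Binary.PropositionalEquality
  using (_≡_; _≢_; refl; sym; trans; cong; cong₂; subst; module ≡-Reasoning)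

elem0≡false : ∀ {xs} → 0 ∉ xs → elem 0 xs ≡ false
elem0≡false {[]}        _  = refl
elem0≡false {zero ∷ _}  0∉ = ⊥-elim (0∉ (here refl))
elem0≡false {suc _ ∷ _} 0∉ = elem0≡false (λ 0∈ → 0∉ (there 0∈))

elem0≡true : ∀ {xs} → 0 ∈ xs → elem 0 xs ≡ true
elem0≡true {zero ∷ _}  _          = refl
elem0≡true {suc _ ∷ _} (there 0∈) = elem0≡true 0∈

n≤mexFrom : ∀ n k xs → n ≤ mexFrom n k xs
n≤mexFrom n zero    xs = ≤-refl
n≤mexFrom n (suc k) xs with elem n xs
... | true  = ≤-trans (n≤1+n n) (n≤mexFrom (suc n) k xs)
... | false = ≤-refl

mex≡0 : ∀ {xs} → 0 ∉ xs → mex xs ≡ 0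
mex≡0 {[]}     _  = refl
mex≡0 {x ∷ xs} 0∉ rewrite elem0≡false 0∉ = refl

mex≢0 : ∀ {xs} → 0 ∈ xs → mex xs ≢ 0
mex≢0 {x ∷ xs} 0∈ rewrite elem0≡true 0∈ = m<n⇒n≢0 (n≤mexFrom 1 (length xs) (x ∷ xs))

cellMoves : Matrix → Fin 3 → Fin 3 → List Matrix
cellMoves M i j = if isZero (M i j) then [] else decr M i j ∷ []

movesFrom : Matrix → Fin 3 → List Matrix
movesFrom M i = concatMap (cellMoves M i) (allFin 3)

moves : Matrix → List Matrix
moves M = concatMap (movesFrom M) (allFin 3)

options-live : ∀ {M} → ended M ≡ false → options M ≡ moves M
options-live live rewrite live = refl

∈-cellMoves⁺ : ∀ M i j → 0 < M i j → decr M i j ∈ cellMoves M i j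
∈-cellMoves⁺ M i j pos with M i j | pos
... | suc _ | _ = here refl

∈-cellMoves⁻ : ∀ M i j {X} → X ∈ cellMoves M i j → 0 < M i j × X ≡ decr M i j
∈-cellMoves⁻ M i j X∈ with M i j | X∈
... | suc _ | here X≡ = z<s , X≡

∈-options⁺ : ∀ {M} i j → ended M ≡ false → 0 < M i j → decr M i j ∈ options M
∈-options⁺ {M} i j live pos = subst (decr M i j ∈_) (sym (options-live {M} live))
  (∈-concatMap⁺ (movesFrom M) (lose (∈-allFin i)
    (∈-concatMap⁺ (cellMoves M i) (lose (∈-allFin j) (∈-cellMoves⁺ M i j pos)))))

∈-options⁻ : ∀ {M X} → X ∈ options M → ∃₂ λ i j → 0 < M i j × X ≡ decr M i j
∈-options⁻ {M} X∈ with ended M | X∈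
... | false | X∈moves =
  let i , X∈ᵢ  = satisfied (∈-concatMap⁻ (movesFrom M) {allFin 3} X∈moves)
      j , X∈ᵢⱼ = satisfied (∈-concatMap⁻ (cellMoves M i) {allFin 3} X∈ᵢ)
  in i , j , ∈-cellMoves⁻ M i j X∈ᵢⱼ

nimFuel-ended : ∀ k {M} → ended M ≡ true → nimFuel k M ≡ 0
nimFuel-ended zero    _    = refl
nimFuel-ended (suc k) over rewrite over = refl

nimFuel-suc≡0 : ∀ k {M} → (∀ i j → 0 < M i j → nimFuel k (decr M i j) ≢ 0) →
                nimFuel (suc k) M ≡ 0
nimFuel-suc≡0 k {M} h = mex≡0 λ 0∈ →
  let X , X∈ , 0≡ = ∈-map⁻ (nimFuel k) 0∈
      i , j , pos , X≡ = ∈-options⁻ {M} X∈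
  in h i j pos (trans (sym (cong (nimFuel k) X≡)) (sym 0≡))

nimFuel-suc≢0 : ∀ k {M} i j → ended M ≡ false → 0 < M i j → nimFuel k (decr M i j) ≡ 0 →
                nimFuel (suc k) M ≢ 0
nimFuel-suc≢0 k i j live pos h =
  mex≢0 (subst (_∈ _) h (∈-map⁺ (nimFuel k) (∈-options⁺ i j live pos)))

sum3 : (Fin 3 → ℕ) → ℕ
sum3 v = v 0F + v 1F + v 2F

data Edge : Set where
  top bottom left right : Edge

line : Matrix → Edge → Fin 3 → ℕ
line M top    = M 0F
line M bottom = M 2F
line M left   = λ k → M k 0F
line M right  = λ k → M k 2F

edgeSum : Matrix → Edge → ℕ
edgeSum M e = sum3 (line M e)

line-pointwise : ∀ {R : ℕ → ℕ → Set} {M N} → (∀ i j → R (M i j) (N i j)) →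
                 ∀ e x → R (line M e x) (line N e x)
line-pointwise R top    = R 0F
line-pointwise R bottom = R 2F
line-pointwise R left   = λ k → R k 0F
line-pointwise R right  = λ k → R k 2F

edgeSum-mono : ∀ {M N} → (∀ i j → M i j ≤ N i j) → ∀ e → edgeSum M e ≤ edgeSum N e
edgeSum-mono {M} {N} M≤N e = +-mono-≤ (+-mono-≤ (≤ₗ 0F) (≤ₗ 1F)) (≤ₗ 2F)
  where
  ≤ₗ : ∀ x → line M e x ≤ line N e x
  ≤ₗ = line-pointwise {R = _≤_} M≤N e

ended-edge : ∀ {M} e → edgeSum M e ≡ 0 → ended M ≡ true
ended-edge top h rewrite h = refl
ended-edge {M} bottom h rewrite h = ∨-zeroʳ (isZero (edgeSum M top))
ended-edge {M} left h rewrite h | ∨-zeroʳ (isZero (edgeSum M bottom)) =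
  ∨-zeroʳ (isZero (edgeSum M top))
ended-edge {M} right h
  rewrite h | ∨-zeroʳ (isZero (edgeSum M left)) | ∨-zeroʳ (isZero (edgeSum M bottom)) =
  ∨-zeroʳ (isZero (edgeSum M top))

isZero-pos : ∀ {n} → 0 < n → isZero n ≡ false
isZero-pos z<s = refl

ended≡false : ∀ {M} → (∀ e → 0 < edgeSum M e) → ended M ≡ false
ended≡false h
  rewrite isZero-pos (h top) | isZero-pos (h bottom) | isZero-pos (h left) | isZero-pos (h right) =
  refl

edgeSum>0 : ∀ {M} → ended M ≡ false → ∀ e → 0 < edgeSum M e
edgeSum>0 live e = n≢0⇒n>0 λ h → contradiction (trans (sym (ended-edge e h)) live) λ ()

decr-≤ : ∀ M i j k l → decr M i j k l ≤ M k l
decr-≤ M i j k l with ⌊ i ≟ k ⌋ | ⌊ j ≟ l ⌋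
... | true  | true  = m∸n≤m (M k l) 1
... | true  | false = ≤-refl
... | false | _     = ≤-refl

ended-decr : ∀ {M} i j → ended (decr M i j) ≡ false → ended M ≡ false
ended-decr {M} i j live =
  ended≡false λ e → ≤-trans (edgeSum>0 live e) (edgeSum-mono (decr-≤ M i j) e)

infix 4 _≋_
_≋_ : Matrix → Matrix → Set
M ≋ N = ∀ i j → M i j ≡ N i j

edgeSum-cong : ∀ {M N} → M ≋ N → ∀ e → edgeSum M e ≡ edgeSum N e
edgeSum-cong {M} {N} M≋N e = cong₂ _+_ (cong₂ _+_ (≡ₗ 0F) (≡ₗ 1F)) (≡ₗ 2F)
  where
  ≡ₗ : ∀ x → line M e x ≡ line N e x
  ≡ₗ = line-pointwise {R = _≡_} M≋N e

ended-cong : ∀ {M N} → M ≋ N → ended M ≡ ended N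
ended-cong M≋N rewrite edgeSum-cong M≋N top | edgeSum-cong M≋N bottom
                     | edgeSum-cong M≋N left | edgeSum-cong M≋N right = refl

decr-cong : ∀ {M N} → M ≋ N → ∀ i j → decr M i j ≋ decr N i j
decr-cong M≋N i j k l =
  cong (λ x → if ⌊ i ≟ k ⌋ then (if ⌊ j ≟ l ⌋ then x ∸ 1 else x) else x) (M≋N k l)

cellMoves-cong : ∀ {M N} → M ≋ N → ∀ i j → Pointwise _≋_ (cellMoves M i j) (cellMoves N i j)
cellMoves-cong {M} {N} M≋N i j rewrite M≋N i j with isZero (N i j)
... | true  = []
... | false = decr-cong M≋N i j ∷ []

options-cong : ∀ {M N} → M ≋ N → Pointwise _≋_ (options M) (options N)
options-cong {M} {N} M≋N rewrite ended-cong M≋N with ended N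
... | true  = []
... | false = concatMap⁺ {movesFrom M} {movesFrom N} (λ i → concatMap⁺ (cellMoves-cong M≋N i))
  where
  concatMap⁺ : ∀ {f g : Fin 3 → List Matrix} → (∀ x → Pointwise _≋_ (f x) (g x)) →
               Pointwise _≋_ (concatMap f (allFin 3)) (concatMap g (allFin 3))
  concatMap⁺ {f} {g} f≋g =
    Pointwise.concat⁺ (Pointwise.map⁺ f g (Pointwise.refl (λ {x} → f≋g x) {allFin 3}))

nimFuel-cong : ∀ k {M N} → M ≋ N → nimFuel k M ≡ nimFuel k N
nimFuel-cong zero    _   = refl
nimFuel-cong (suc k) M≋N = cong mex (Pointwise.Pointwise-≡⇒≡
  (Pointwise.map⁺ (nimFuel k) (nimFuel k) (Pointwise.map (nimFuel-cong k) (options-cong M≋N))))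

-- Without function extensionality a position is only determined up to _≋_.
-- matOf reads off the nine entries, so matOf of a position built by decr
-- from an explicit mat normalises to an explicit mat.
matOf : Matrix → Matrix
matOf M = mat (M 0F 0F) (M 0F 1F) (M 0F 2F) (M 1F 0F) (M 1F 1F) (M 1F 2F) (M 2F 0F) (M 2F 1F) (M 2F 2F)

≋-matOf : ∀ M → M ≋ matOf M
≋-matOf M 0F 0F = refl
≋-matOf M 0F 1F = refl
≋-matOf M 0F 2F = refl
≋-matOf M 1F 0F = refl
≋-matOf M 1F 1F = refl
≋-matOf M 1F 2F = refl
≋-matOf M 2F 0F = refl
≋-matOf M 2F 1F = refl
≋-matOf M 2F 2F = refl

decrAt : (Fin 3 → ℕ) → Fin 3 → Fin 3 → ℕ
decrAt v x y = if ⌊ x ≟ y ⌋ then v y ∸ 1 else v y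

sum3-decrAt : ∀ v x → 0 < v x → suc (sum3 (decrAt v x)) ≡ sum3 v
sum3-decrAt v 0F pos with v 0F | pos
... | suc _ | _ = refl
sum3-decrAt v 1F pos with v 1F | pos
... | suc n | _ = sym (cong (_+ v 2F) (+-suc (v 0F) n))
sum3-decrAt v 2F pos with v 2F | pos
... | suc n | _ = sym (+-suc (v 0F + v 1F) n)

sum3-pos : ∀ v → 0 < sum3 v → ∃ λ x → 0 < v x
sum3-pos v h with v 0F in p
... | suc _ = 0F , subst (0 <_) (sym p) z<s
... | zero with v 1F in q
...   | suc _ = 1F , subst (0 <_) (sym q) z<s
...   | zero  = 2F , h

sum3≡1⇒ : ∀ v → sum3 v ≡ 1 → ∃ λ x → 0 < v x × sum3 (decrAt v x) ≡ 0
sum3≡1⇒ v h =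
  let x , pos = sum3-pos v (≤-reflexive (sym h))
  in x , pos , suc-injective (trans (sum3-decrAt v x pos) h)

edgeSum≡1⇒nimFuel≢0 : ∀ k {M} e → ended M ≡ false → edgeSum M e ≡ 1 → nimFuel (suc k) M ≢ 0
edgeSum≡1⇒nimFuel≢0 k {M} e live h = empty e (sum3≡1⇒ (line M e) h)
  where
  emptying : ∀ i j → 0 < M i j → ended (decr M i j) ≡ true → nimFuel (suc k) M ≢ 0
  emptying i j pos over = nimFuel-suc≢0 k {M} i j live pos (nimFuel-ended k over)
  empty : ∀ e → (∃ λ x → 0 < line M e x × sum3 (decrAt (line M e) x) ≡ 0) →
          nimFuel (suc k) M ≢ 0
  empty top    (x , pos , h) = emptying 0F x pos (ended-edge {decr M 0F x} top h)
  empty bottom (x , pos , h) = emptying 2F x pos (ended-edge {decr M 2F x} bottom h)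
  empty left   (x , pos , h) = emptying x 0F pos (ended-edge {decr M x 0F} left h)
  empty right  (x , pos , h) = emptying x 2F pos (ended-edge {decr M x 2F} right h)

centroSym : ℕ → ℕ → ℕ → ℕ → Matrix
centroSym a b c d = mat a b c d 0 d c b a

+-reverse : ∀ x y z → x + y + z ≡ z + y + x
+-reverse = solve-∀

+-suc-middle : ∀ x y z → x + suc y + z ≡ suc (x + y + z)
+-suc-middle x y z = cong (_+ z) (+-suc x y)

≤-pred-≡ : ∀ {x y x′ y′} → x′ ≡ suc x → y′ ≡ suc y → x′ ≤ y′ → x ≤ y
≤-pred-≡ refl refl = s≤s⁻¹

centroSym-live : ∀ {a b c d} → 0 < a + b + c → 0 < a + d + c →
                 ended (centroSym a b c d) ≡ false
centroSym-live {a} {b} {c} {d} t l = ended≡false {centroSym a b c d} λ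
  { top    → t
  ; bottom → subst (0 <_) (+-reverse a b c) t
  ; left   → l
  ; right  → subst (0 <_) (+-reverse a d c) l
  }

-- The fuel has to be odd: with fuel 1 every live position gets the value 1.
CentroSymLosing : ℕ → Set
CentroSymLosing m = ∀ a b c d → 2 ≤ a + b + c → 2 ≤ a + d + c → a + b + c + d ≤ m →
                    nimFuel (suc (m + m)) (centroSym a b c d) ≡ 0

-- N is the position after the opponent's move and (i, j) the mirrored cell.
-- The new top and left edge sums are edge sums of N already, so if one of
-- them is 1 we empty that edge of N instead of mirroring.
mirror-reply : ∀ {m} → CentroSymLosing m → ∀ N i j a b c d →
               matOf (decr N i j) ≡ centroSym a b c d → 0 < N i j →
               (∃ λ e → edgeSum N e ≡ a + b + c) → (∃ λ e → edgeSum N e ≡ a + d + c) →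
               0 < a + b + c → 0 < a + d + c → a + b + c + d ≤ m →
               nimFuel (suc (suc (m + m))) N ≢ 0
mirror-reply {m} ih N i j a b c d reply≡ pos (eᵗ , eᵗ≡) (eˡ , eˡ≡) t>0 l>0 bound =
  respond (m≤n⇒m<n∨m≡n t>0) (m≤n⇒m<n∨m≡n l>0)
  where
  live : ended N ≡ false
  live = ended-decr {N} i j
    (subst (λ X → ended X ≡ false) (sym reply≡) (centroSym-live {a} {b} {c} {d} t>0 l>0))
  respond : 1 < a + b + c ⊎ 1 ≡ a + b + c → 1 < a + d + c ⊎ 1 ≡ a + d + c →
            nimFuel (suc (suc (m + m))) N ≢ 0
  respond (inj₂ 1≡t) _ =
    edgeSum≡1⇒nimFuel≢0 (suc (m + m)) {N} eᵗ live (trans eᵗ≡ (sym 1≡t))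
  respond (inj₁ _) (inj₂ 1≡l) =
    edgeSum≡1⇒nimFuel≢0 (suc (m + m)) {N} eˡ live (trans eˡ≡ (sym 1≡l))
  respond (inj₁ t>1) (inj₁ l>1) = nimFuel-suc≢0 (suc (m + m)) {N} i j live pos (begin
    nimFuel (suc (m + m)) (decr N i j)          ≡⟨ nimFuel-cong (suc (m + m)) (≋-matOf (decr N i j)) ⟩
    nimFuel (suc (m + m)) (matOf (decr N i j))  ≡⟨ cong (nimFuel (suc (m + m))) reply≡ ⟩
    nimFuel (suc (m + m)) (centroSym a b c d)   ≡⟨ ih a b c d t>1 l>1 bound ⟩
    0                                           ∎)
    where open ≡-Reasoning

mirror-move : ∀ {m} → CentroSymLosing m → ∀ i j a b c d → 0 < centroSym a b c d i j →
              2 ≤ a + b + c → 2 ≤ a + d + c → a + b + c + d ≤ suc m →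
              nimFuel (suc (suc (m + m))) (decr (centroSym a b c d) i j) ≢ 0
mirror-move ih 0F 0F (suc a) b c d _ t l s =
  mirror-reply ih (decr (centroSym (suc a) b c d) 0F 0F) 2F 2F a b c d refl z<s
    (top , refl) (left , refl) (s≤s⁻¹ t) (s≤s⁻¹ l) (s≤s⁻¹ s)
mirror-move ih 2F 2F (suc a) b c d _ t l s =
  mirror-reply ih (decr (centroSym (suc a) b c d) 2F 2F) 0F 0F a b c d refl z<s
    (bottom , +-reverse c b a) (right , +-reverse c d a) (s≤s⁻¹ t) (s≤s⁻¹ l) (s≤s⁻¹ s)
mirror-move ih 0F 1F a (suc b) c d _ t l s =
  mirror-reply ih (decr (centroSym a (suc b) c d) 0F 1F) 2F 1F a b c d refl z<s
    (top , refl) (left , refl)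
    (≤-pred-≡ refl (+-suc-middle a b c) t) (<⇒≤ l)
    (≤-pred-≡ (cong (_+ d) (+-suc-middle a b c)) refl s)
mirror-move ih 2F 1F a (suc b) c d _ t l s =
  mirror-reply ih (decr (centroSym a (suc b) c d) 2F 1F) 0F 1F a b c d refl z<s
    (bottom , +-reverse c b a) (left , refl)
    (≤-pred-≡ refl (+-suc-middle a b c) t) (<⇒≤ l)
    (≤-pred-≡ (cong (_+ d) (+-suc-middle a b c)) refl s)
mirror-move ih 0F 2F a b (suc c) d _ t l s =
  mirror-reply ih (decr (centroSym a b (suc c) d) 0F 2F) 2F 0F a b c d refl z<s
    (top , refl) (right , +-reverse c d a)
    (≤-pred-≡ refl (+-suc (a + b) c) t) (≤-pred-≡ refl (+-suc (a + d) c) l)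
    (≤-pred-≡ (cong (_+ d) (+-suc (a + b) c)) refl s)
mirror-move ih 2F 0F a b (suc c) d _ t l s =
  mirror-reply ih (decr (centroSym a b (suc c) d) 2F 0F) 0F 2F a b c d refl z<s
    (bottom , +-reverse c b a) (left , refl)
    (≤-pred-≡ refl (+-suc (a + b) c) t) (≤-pred-≡ refl (+-suc (a + d) c) l)
    (≤-pred-≡ (cong (_+ d) (+-suc (a + b) c)) refl s)
mirror-move ih 1F 0F a b c (suc d) _ t l s =
  mirror-reply ih (decr (centroSym a b c (suc d)) 1F 0F) 1F 2F a b c d refl z<s
    (top , refl) (left , refl)
    (<⇒≤ t) (≤-pred-≡ refl (+-suc-middle a d c) l) (≤-pred-≡ (+-suc (a + b + c) d) refl s)
mirror-move ih 1F 2F a b c (suc d) _ t l s =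
  mirror-reply ih (decr (centroSym a b c (suc d)) 1F 2F) 1F 0F a b c d refl z<s
    (top , refl) (right , +-reverse c d a)
    (<⇒≤ t) (≤-pred-≡ refl (+-suc-middle a d c) l) (≤-pred-≡ (+-suc (a + b + c) d) refl s)

centroSym-losing : ∀ m → CentroSymLosing m
centroSym-losing zero    a b c d t _ s =
  contradiction (≤-trans t (≤-trans (m≤m+n (a + b + c) d) s)) λ ()
centroSym-losing (suc m) a b c d t l s = nimFuel-suc≡0 (suc m + suc m) λ i j pos →
  subst (λ k → nimFuel (suc k) (decr (centroSym a b c d) i j) ≢ 0) (sym (+-suc m m))
    (mirror-move (centroSym-losing m) i j a b c d pos t l s)

totalSum-centroSym : ∀ b d →
  (1 + b + 1) + (d + 0 + d) + (1 + b + 1) ≡ (1 + b + 1 + d) + (1 + b + 1 + d)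
totalSum-centroSym = solve-∀

mainTheorem12 : (b d : ℕ) → nimTER (mat 1 b 1 d 0 d 1 b 1) ≡ 0
mainTheorem12 b d =
  subst (λ k → nimFuel (suc k) (centroSym 1 b 1 d) ≡ 0) (sym (totalSum-centroSym b d))
    (centroSym-losing (1 + b + 1 + d) 1 b 1 d (s≤s (m≤n+m 1 b)) (s≤s (m≤n+m 1 d)) ≤-refl)
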